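{- Let $G$ be a $k$-tangle-unbreakable hypergraph and $(A,\overline A)$ a separation of $G$ such that both $A$ and $\overline A$ are tri-well-linked. Then both $G\triangleleft A$ and $G\triangleleft\overline A$ are $k$-tangle-unbreakable.
   Context: A hypergraph $G$ consists of finite sets $V(G)$, $E(G)$ and for each hyperedge $e$ a set $V(e)\subseteq V(G)$ (distinct hyperedges may share vertex sets), every vertex lying in some $V(e)$. For $X\subseteq E(H)$ in a hypergraph $H$: $V(X)=\bigcup_{e\in X}V(e)$, $\overline X=E(H)\setminus X$, $\mathrm{bd}(X)=V(X)\cap V(\overline X)$, $\lambda(X)=|\mathrm{bd}(X)|$. A separation is a pair $(X,\overline X)$ of order $\lambda(X)$. $X$ is tri-well-linked if for every triple of pairwise disjoint, possibly empty, sets $B_1,B_2,B_3$ with union $X$, some $\lambda(B_i)\ge\lambda(X)$. A tangle of order $k'$ of $H$ is a family $\mathscr{T}$ of subsets of $E(H)$ with: (1) $\lambda(X)<k'$ for all $X\in\mathscr{T}$; (2) for every $X$ with $\lambda(X)<k'$, $X\in\mathscr{T}$ or $\overline X\in\mathscr{T}$; (3) no $X,Y,Z\in\mathscr{T}$ with $X\cup Y\cup Z=E(H)$; (4) $E(H)\setminus\{e\}\notin\mathscr{T}$ for all $e$. A separation $(X,\overline X)$ distinguishes tangles $\mathscr{T}_1,\mathscr{T}_2$ if $X\in\mathscr{T}_1$, $\overline X\in\mathscr{T}_2$. $H$ is $k$-tangle-unbreakable if no separation of $H$ of order $<k$ distinguishes two tangles of $H$. $G\triangleleft X$ is the hypergraph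 with vertex set $V(\overline X)$ and hyperedges $\overline X\cup\{e_X\}$, where $e_X$ is new with $V(e_X)=\mathrm{bd}(X)$. -}

module Defs where

open import Data.Nat using (ℕ; suc; _<_; _≥_)
open import Data.Bool using (Bool; true; false; if_then_else_)
open import Data.Fin using (Fin)
open import Data.List using (List; []; _∷_; length)
open import Data.Vec using ([]; _∷_)
open import Data.Fin.Subset using (Subset; ⊥; ⊤; ∁; _∩_; _∪_; ⋃; ∣_∣; ⁅_⁆)
open import Data.Product using (_×_)
open import Data.Sum using (_⊎_)
open import Relation.Binary.PropositionalEquality using (_≡_; _≢_)
open import Relation.Nullary using (¬_)

-- A hypergraph: an ambient finite vertex type Fin nV and a finite list of
-- hyperedges, each given by its vertex set V(e) ⊆ Fin nV (repetitions of
-- vertex sets are allowed).  Hyperedges are the positions in the list,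
-- i.e. E(H) = Fin (length edges).  The vertex set V(H) is understood as
-- the union of all V(e) (every vertex lies in some hyperedge).
record Hypergraph : Set where
  constructor hypergraph
  field
    nV    : ℕ
    edges : List (Subset nV)

open Hypergraph public

nE : Hypergraph → ℕ
nE H = length (edges H)

EdgeSet : Hypergraph → Set
EdgeSet H = Subset (nE H)

keep : ∀ {A : Set} (xs : List A) → Subset (length xs) → List A
keep []       []          = []
keep (x ∷ xs) (true ∷ s)  = x ∷ keep xs s
keep (x ∷ xs) (false ∷ s) = keep xs s

VX : (H : Hypergraph) → EdgeSet H → Subset (nV H)
VX H X = ⋃ (keep (edges H) X)

bd : (H : Hypergraph) → EdgeSet H → Subset (nV H)
bd H X = VX H X ∩ VX H (∁ X)

lam : (H : Hypergraph) → EdgeSet H → ℕ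
lam H X = ∣ bd H X ∣

TriWellLinked : (H : Hypergraph) → EdgeSet H → Set
TriWellLinked H X =
  (B₁ B₂ B₃ : EdgeSet H) →
  B₁ ∩ B₂ ≡ ⊥ → B₁ ∩ B₃ ≡ ⊥ → B₂ ∩ B₃ ≡ ⊥ →
  B₁ ∪ B₂ ∪ B₃ ≡ X →
  (lam H B₁ ≥ lam H X) ⊎ (lam H B₂ ≥ lam H X) ⊎ (lam H B₃ ≥ lam H X)

Family : Hypergraph → Set
Family H = EdgeSet H → Bool

InF : (H : Hypergraph) → EdgeSet H → Family H → Set
InF H X T = T X ≡ true

IsTangle : (H : Hypergraph) → ℕ → Family H → Set
IsTangle H k' T =
  (∀ (X : EdgeSet H) → InF H X T → lam H X < k') ×
  (∀ (X : EdgeSet H) → lam H X < k' → InF H X T ⊎ InF H (∁ X) T) ×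
  (∀ (X Y Z : EdgeSet H) → InF H X T → InF H Y T → InF H Z T → X ∪ Y ∪ Z ≢ ⊤) ×
  (∀ (e : Fin (nE H)) → ¬ InF H (∁ ⁅ e ⁆) T)

Distinguishes : (H : Hypergraph) → EdgeSet H → Family H → Family H → Set
Distinguishes H X T₁ T₂ = InF H X T₁ × InF H (∁ X) T₂

TangleUnbreakable : ℕ → Hypergraph → Set
TangleUnbreakable k H =
  ∀ (k₁ k₂ : ℕ) (T₁ T₂ : Family H) → IsTangle H k₁ T₁ → IsTangle H k₂ T₂ →
  ∀ (X : EdgeSet H) → lam H X < k → ¬ Distinguishes H X T₁ T₂

-- G ◁ X : hyperedges X̄ together with a new hyperedge e_X (placed first)
-- with V(e_X) = bd(X); vertex set V(X̄) (= union of the new hyperedges).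
_◁_ : (G : Hypergraph) → EdgeSet G → Hypergraph
G ◁ X = hypergraph (nV G) (bd G X ∷ keep (edges G) (∁ X))

-- A tangle T of order k′ of G ◁ A pulls back to a tangle of G of the same order: a set Y of
-- hyperedges of G with λ(Y) < k′ belongs to the pullback when T contains one of its two
-- contractions, Y ∪ A or Y ∖ A with A collapsed to the hyperedge e_A. Separations of G ◁ A
-- lift to separations of G of the same order, so a small separation distinguishing two tangles
-- of G ◁ A lifts to one distinguishing their pullbacks. Tri-well-linkedness enters through
-- submodularity of λ: since A is tri-well-linked, one of the two contractions of Y has order at
-- most λ(Y), and three sets covering E(G) cannot all meet A in sets of order below λ(A); since
-- Ā is tri-well-linked, T cannot contain both Y ∖ A and Ȳ ∖ A, because then λ(A) < k′ and the
-- singleton {e_A} would complete a cover of E(G ◁ A).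
module Submission where

open import Algebra.Bundles using (CommutativeMonoid)
import Algebra.Lattice.Properties.BooleanAlgebra as BooleanAlgebraProperties
import Algebra.Properties.CommutativeSemigroup as CommutativeSemigroupProperties
import Algebra.Properties.IdempotentCommutativeMonoid as IdempotentCommutativeMonoidProperties
open import Data.Bool using (Bool; true; false; not; _∨_)
open import Data.Bool.Properties using (∨-inverseʳ; T-≡; _≟_)
open import Data.Empty using (⊥-elim) renaming (⊥ to Empty)
open import Data.Fin using (Fin; zero; suc)
open import Data.Fin.Subset
  using (Subset; ⊥; ⊤; ∁; _∩_; _∪_; ⋃; ∣_∣; ⁅_⁆; _∈_; _∉_; _⊆_; inside; outside)
open import Data.Fin.Subset.Properties
  using (_∈?_; ⊆-antisym; ⊥⊆; p∩q⊆p; p∩q⊆q; p⊆p∪q; q⊆p∪q; x∈p∪q⁻; x∈p∪q⁺; x∈p∩q⁻; x∈p∩q⁺;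
         x∈⁅y⁆⇒x≡y; x∉p⇒x∈∁p; p⊆q⇒∣p∣≤∣q∣; ∣⊥∣≡0;
         ∪-comm; ∪-assoc; ∪-idem; ∪-identityˡ; ∪-identityʳ; ∪-inverseʳ; ∪-distribˡ-∩;
         ∩-comm; ∩-assoc; ∩-identityˡ; ∩-identityʳ; ∩-zeroˡ; ∩-zeroʳ; ∩-inverseʳ; ∩-distribʳ-∪;
         ∪-∩-booleanAlgebra; ∪-commutativeMonoid; ∩-commutativeMonoid; ∪-idempotentCommutativeMonoid)
open import Data.List using (List; []; _∷_; length)
open import Data.Nat using (ℕ; zero; suc; _+_; _≤_; _<_; z≤n; s≤s; _≤?_; _<?_)
open import Data.Nat.Properties
  using (≤-reflexive; ≤-trans; ≤-<-trans; <⇒≤; ≰⇒>; <⇒≱; +-comm; +-suc; +-mono-≤; +-monoʳ-≤; +-cancelʳ-≤;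
         module ≤-Reasoning)
open import Data.Product using (_×_; _,_; proj₁; proj₂; ∃-syntax) renaming (map to map-×)
open import Data.Sum using (_⊎_; inj₁; inj₂; [_,_]′)
open import Data.Vec using ([]; _∷_; here; there)
open import Function using (id; _∘_)
open import Function.Bundles using (Equivalence)
open import Relation.Binary.PropositionalEquality
  using (_≡_; _≢_; refl; sym; trans; cong; cong₂; subst; module ≡-Reasoning)
open import Relation.Nullary using (¬_; Dec; yes; no)
open import Relation.Nullary.Decidable using (⌊_⌋; map′; _⊎-dec_; _×-dec_; toWitness; fromWitness)

open import Defs

module _ {n : ℕ} where
  open BooleanAlgebraProperties (∪-∩-booleanAlgebra n) public
    using () renaming (deMorgan₁ to ∁-∩; deMorgan₂ to ∁-∪; ¬-involutive to ∁-involutive; ¬⊥≈⊤ to ∁⊥≡⊤)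

∣p∪q∣+∣p∩q∣≡∣p∣+∣q∣ : ∀ {n} (p q : Subset n) → ∣ p ∪ q ∣ + ∣ p ∩ q ∣ ≡ ∣ p ∣ + ∣ q ∣
∣p∪q∣+∣p∩q∣≡∣p∣+∣q∣ []            []            = refl
∣p∪q∣+∣p∩q∣≡∣p∣+∣q∣ (inside  ∷ p) (inside  ∷ q) =
  cong suc (trans (+-suc _ _) (trans (cong suc (∣p∪q∣+∣p∩q∣≡∣p∣+∣q∣ p q)) (sym (+-suc _ _))))
∣p∪q∣+∣p∩q∣≡∣p∣+∣q∣ (inside  ∷ p) (outside ∷ q) = cong suc (∣p∪q∣+∣p∩q∣≡∣p∣+∣q∣ p q)
∣p∪q∣+∣p∩q∣≡∣p∣+∣q∣ (outside ∷ p) (inside  ∷ q) =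
  trans (cong suc (∣p∪q∣+∣p∩q∣≡∣p∣+∣q∣ p q)) (sym (+-suc _ _))
∣p∪q∣+∣p∩q∣≡∣p∣+∣q∣ (outside ∷ p) (outside ∷ q) = ∣p∪q∣+∣p∩q∣≡∣p∣+∣q∣ p q

module _ {n : ℕ} where
  open CommutativeSemigroupProperties (CommutativeMonoid.commutativeSemigroup (∪-commutativeMonoid n)) public
    using () renaming (x∙yz≈y∙xz to ∪-left-comm)
  open IdempotentCommutativeMonoidProperties (∪-idempotentCommutativeMonoid n) public
    using () renaming (∙-distrˡ-∙ to ∪-distribˡ-∪)
  open CommutativeSemigroupProperties (CommutativeMonoid.commutativeSemigroup (∩-commutativeMonoid n)) public
    using () renaming (interchange to ∩-interchange; x∙yz≈y∙xz to ∩-left-comm)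

[p∩r∪s]∩q≡[p∪s]∩q : ∀ {n} (p q r s : Subset n) → r ∩ q ≡ q → (p ∩ r ∪ s) ∩ q ≡ (p ∪ s) ∩ q
[p∩r∪s]∩q≡[p∪s]∩q p q r s r∩q≡q = begin
  (p ∩ r ∪ s) ∩ q         ≡⟨ ∩-distribʳ-∪ q (p ∩ r) s ⟩
  (p ∩ r) ∩ q ∪ s ∩ q     ≡⟨ cong (_∪ s ∩ q) (trans (∩-assoc p r q) (cong (p ∩_) r∩q≡q)) ⟩
  p ∩ q ∪ s ∩ q           ≡⟨ sym (∩-distribʳ-∪ q p s) ⟩
  (p ∪ s) ∩ q             ∎
  where open ≡-Reasoning

module _ {n : ℕ} (p q : Subset n) where

  p∩q∪∁p∩q≡q : p ∩ q ∪ ∁ p ∩ q ≡ q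
  p∩q∪∁p∩q≡q = begin
    p ∩ q ∪ ∁ p ∩ q ≡⟨ sym (∩-distribʳ-∪ q p (∁ p)) ⟩
    (p ∪ ∁ p) ∩ q   ≡⟨ cong (_∩ q) (∪-inverseʳ p) ⟩
    ⊤ ∩ q           ≡⟨ ∩-identityˡ q ⟩
    q               ∎
    where open ≡-Reasoning

  p∩q-disjoint-∁p∩q : (p ∩ q) ∩ (∁ p ∩ q) ≡ ⊥
  p∩q-disjoint-∁p∩q = begin
    (p ∩ q) ∩ (∁ p ∩ q) ≡⟨ ∩-interchange p q (∁ p) q ⟩
    (p ∩ ∁ p) ∩ (q ∩ q) ≡⟨ cong (_∩ (q ∩ q)) (∩-inverseʳ p) ⟩
    ⊥ ∩ (q ∩ q)         ≡⟨ ∩-zeroˡ (q ∩ q) ⟩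
    ⊥                   ∎
    where open ≡-Reasoning

  p∪q∩∁p≡p∪q : p ∪ q ∩ ∁ p ≡ p ∪ q
  p∪q∩∁p≡p∪q = begin
    p ∪ q ∩ ∁ p       ≡⟨ ∪-distribˡ-∩ p q (∁ p) ⟩
    (p ∪ q) ∩ (p ∪ ∁ p) ≡⟨ cong ((p ∪ q) ∩_) (∪-inverseʳ p) ⟩
    (p ∪ q) ∩ ⊤       ≡⟨ ∩-identityʳ (p ∪ q) ⟩
    p ∪ q             ∎
    where open ≡-Reasoning

  p-disjoint-q∩∁p : p ∩ (q ∩ ∁ p) ≡ ⊥
  p-disjoint-q∩∁p = begin
    p ∩ (q ∩ ∁ p) ≡⟨ ∩-left-comm p q (∁ p) ⟩
    q ∩ (p ∩ ∁ p) ≡⟨ cong (q ∩_) (∩-inverseʳ p) ⟩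
    q ∩ ⊥         ≡⟨ ∩-zeroʳ q ⟩
    ⊥             ∎
    where open ≡-Reasoning

module _ {n : ℕ} {p q : Subset n} where

  ⊆⇒∪≡ : p ⊆ q → p ∪ q ≡ q
  ⊆⇒∪≡ p⊆q = ⊆-antisym (λ x∈ → [ p⊆q , id ]′ (x∈p∪q⁻ p q x∈)) (q⊆p∪q p q)

  ⊆⇒∩≡ : p ⊆ q → q ∩ p ≡ p
  ⊆⇒∩≡ p⊆q = ⊆-antisym (p∩q⊆q q p) (λ x∈p → x∈p∩q⁺ (p⊆q x∈p , x∈p))

  ⊆-disjoint : {p′ q′ : Subset n} → p′ ⊆ p → q′ ⊆ q → p ∩ q ≡ ⊥ → p′ ∩ q′ ≡ ⊥
  ⊆-disjoint {p′} {q′} p′⊆p q′⊆q p∩q≡⊥ =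
    ⊆-antisym (λ {x} x∈ → subst (x ∈_) p∩q≡⊥ (x∈p∩q⁺ (map-×  p′⊆p q′⊆q (x∈p∩q⁻ p′ q′ x∈)))) ⊥⊆

x∉p⇒⁅x⁆∩∁p≡⁅x⁆ : ∀ {n} {x : Fin n} (p : Subset n) → x ∉ p → ⁅ x ⁆ ∩ ∁ p ≡ ⁅ x ⁆
x∉p⇒⁅x⁆∩∁p≡⁅x⁆ {x = x} p x∉p = ⊆-antisym (p∩q⊆p ⁅ x ⁆ (∁ p)) λ {y} y∈⁅x⁆ →
  x∈p∩q⁺ (y∈⁅x⁆ , subst (_∈ ∁ p) (sym (x∈⁅y⁆⇒x≡y x y∈⁅x⁆)) (x∉p⇒x∈∁p x∉p))

⋃-keep-∪ : ∀ {n} (es : List (Subset n)) (X Y : Subset (length es)) →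
           ⋃ (keep es (X ∪ Y)) ≡ ⋃ (keep es X) ∪ ⋃ (keep es Y)
⋃-keep-∪ []       []          []          = sym (∪-idem ⊥)
⋃-keep-∪ (e ∷ es) (true  ∷ X) (true  ∷ Y) = trans (cong (e ∪_) (⋃-keep-∪ es X Y)) (∪-distribˡ-∪ e _ _)
⋃-keep-∪ (e ∷ es) (true  ∷ X) (false ∷ Y) = trans (cong (e ∪_) (⋃-keep-∪ es X Y)) (sym (∪-assoc e _ _))
⋃-keep-∪ (e ∷ es) (false ∷ X) (true  ∷ Y) = trans (cong (e ∪_) (⋃-keep-∪ es X Y)) (∪-left-comm e _ _)
⋃-keep-∪ (e ∷ es) (false ∷ X) (false ∷ Y) = ⋃-keep-∪ es X Y

⋃-keep-⊥ : ∀ {n} (es : List (Subset n)) → ⋃ (keep es ⊥) ≡ ⊥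
⋃-keep-⊥ []       = refl
⋃-keep-⊥ (e ∷ es) = ⋃-keep-⊥ es

module _ (H : Hypergraph) where

  VX-∪ : (X Y : EdgeSet H) → VX H (X ∪ Y) ≡ VX H X ∪ VX H Y
  VX-∪ = ⋃-keep-∪ (edges H)

  VX-mono : {X Y : EdgeSet H} → X ⊆ Y → VX H X ⊆ VX H Y
  VX-mono {X} {Y} X⊆Y = subst (VX H X ⊆_) (trans (sym (VX-∪ X Y)) (cong (VX H) (⊆⇒∪≡ X⊆Y))) (p⊆p∪q (VX H Y))

  bd-∁ : (X : EdgeSet H) → bd H (∁ X) ≡ bd H X
  bd-∁ X = trans (cong (λ Y → VX H (∁ X) ∩ VX H Y) (∁-involutive X)) (∩-comm _ _)

  λ-∁ : (X : EdgeSet H) → lam H (∁ X) ≡ lam H X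
  λ-∁ X = cong ∣_∣ (bd-∁ X)

  λ-⊥ : lam H ⊥ ≡ 0
  λ-⊥ = begin
    ∣ VX H ⊥ ∩ VX H (∁ ⊥) ∣ ≡⟨ cong (λ V → ∣ V ∩ VX H (∁ ⊥) ∣) (⋃-keep-⊥ (edges H)) ⟩
    ∣ ⊥ ∩ VX H (∁ ⊥) ∣      ≡⟨ cong ∣_∣ (∩-zeroˡ (VX H (∁ ⊥))) ⟩
    ∣ ⊥ {nV H} ∣            ≡⟨ ∣⊥∣≡0 (nV H) ⟩
    0                       ∎
    where open ≡-Reasoning

  λ-submodular : (X Y : EdgeSet H) → lam H (X ∪ Y) + lam H (X ∩ Y) ≤ lam H X + lam H Y
  λ-submodular X Y = begin
    ∣ bd H (X ∪ Y) ∣ + ∣ bd H (X ∩ Y) ∣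
      ≡⟨ sym (∣p∪q∣+∣p∩q∣≡∣p∣+∣q∣ (bd H (X ∪ Y)) (bd H (X ∩ Y))) ⟩
    ∣ bd H (X ∪ Y) ∪ bd H (X ∩ Y) ∣ + ∣ bd H (X ∪ Y) ∩ bd H (X ∩ Y) ∣
      ≤⟨ +-mono-≤ (p⊆q⇒∣p∣≤∣q∣ union-bound) (p⊆q⇒∣p∣≤∣q∣ intersection-bound) ⟩
    ∣ bd H X ∪ bd H Y ∣ + ∣ bd H X ∩ bd H Y ∣
      ≡⟨ ∣p∪q∣+∣p∩q∣≡∣p∣+∣q∣ (bd H X) (bd H Y) ⟩
    ∣ bd H X ∣ + ∣ bd H Y ∣ ∎
    where
    open ≤-Reasoning

    VX-∪⁻ : ∀ {v} (P Q : EdgeSet H) → v ∈ VX H (P ∪ Q) → v ∈ VX H P ⊎ v ∈ VX H Q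
    VX-∪⁻ {v} P Q = x∈p∪q⁻ (VX H P) (VX H Q) ∘ subst (v ∈_) (VX-∪ P Q)

    VX-∩⁻ : ∀ {v} (P Q : EdgeSet H) → v ∈ VX H (P ∩ Q) → v ∈ VX H P × v ∈ VX H Q
    VX-∩⁻ P Q v∈ = VX-mono (p∩q⊆p P Q) v∈ , VX-mono (p∩q⊆q P Q) v∈

    outside-∪ : ∀ {v} → v ∈ VX H (∁ (X ∪ Y)) → v ∈ VX H (∁ X) × v ∈ VX H (∁ Y)
    outside-∪ {v} = VX-∩⁻ (∁ X) (∁ Y) ∘ subst (λ P → v ∈ VX H P) (∁-∪ X Y)

    outside-∩ : ∀ {v} → v ∈ VX H (∁ (X ∩ Y)) → v ∈ VX H (∁ X) ⊎ v ∈ VX H (∁ Y)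
    outside-∩ {v} = VX-∪⁻ (∁ X) (∁ Y) ∘ subst (λ P → v ∈ VX H P) (∁-∩ X Y)

    union-bound : bd H (X ∪ Y) ∪ bd H (X ∩ Y) ⊆ bd H X ∪ bd H Y
    union-bound v∈ with x∈p∪q⁻ (bd H (X ∪ Y)) (bd H (X ∩ Y)) v∈
    ... | inj₁ v∈bd with x∈p∩q⁻ _ _ v∈bd
    ...   | in-X∪Y , out-X∪Y with outside-∪ out-X∪Y | VX-∪⁻ X Y in-X∪Y
    ...     | out-X , _ | inj₁ in-X = x∈p∪q⁺ (inj₁ (x∈p∩q⁺ (in-X , out-X)))
    ...     | _ , out-Y | inj₂ in-Y = x∈p∪q⁺ (inj₂ (x∈p∩q⁺ (in-Y , out-Y)))
    union-bound v∈ | inj₂ v∈bd with x∈p∩q⁻ _ _ v∈bd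
    ...   | in-X∩Y , out-X∩Y with VX-∩⁻ X Y in-X∩Y | outside-∩ out-X∩Y
    ...     | in-X , _ | inj₁ out-X = x∈p∪q⁺ (inj₁ (x∈p∩q⁺ (in-X , out-X)))
    ...     | _ , in-Y | inj₂ out-Y = x∈p∪q⁺ (inj₂ (x∈p∩q⁺ (in-Y , out-Y)))

    intersection-bound : bd H (X ∪ Y) ∩ bd H (X ∩ Y) ⊆ bd H X ∩ bd H Y
    intersection-bound v∈ with x∈p∩q⁻ _ _ v∈
    ... | v∈bd∪ , v∈bd∩ with outside-∪ (proj₂ (x∈p∩q⁻ _ _ v∈bd∪)) | VX-∩⁻ X Y (proj₁ (x∈p∩q⁻ _ _ v∈bd∩))
    ...   | out-X , out-Y | in-X , in-Y = x∈p∩q⁺ (x∈p∩q⁺ (in-X , out-X) , x∈p∩q⁺ (in-Y , out-Y))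

  λ-posimodular : (X Y : EdgeSet H) → lam H (X ∩ ∁ Y) + lam H (Y ∩ ∁ X) ≤ lam H X + lam H Y
  λ-posimodular X Y = begin
    lam H (X ∩ ∁ Y) + lam H (Y ∩ ∁ X) ≡⟨ +-comm (lam H (X ∩ ∁ Y)) _ ⟩
    lam H (Y ∩ ∁ X) + lam H (X ∩ ∁ Y) ≡⟨ cong (_+ lam H (X ∩ ∁ Y)) λY∖X≡λX∪∁Y ⟩
    lam H (X ∪ ∁ Y) + lam H (X ∩ ∁ Y) ≤⟨ λ-submodular X (∁ Y) ⟩
    lam H X + lam H (∁ Y)             ≡⟨ cong (lam H X +_) (λ-∁ Y) ⟩
    lam H X + lam H Y                 ∎
    where
    open ≤-Reasoning
    λY∖X≡λX∪∁Y : lam H (Y ∩ ∁ X) ≡ lam H (X ∪ ∁ Y)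
    λY∖X≡λX∪∁Y = trans (cong (lam H) Y∖X≡∁[X∪∁Y]) (λ-∁ (X ∪ ∁ Y))
      where
      Y∖X≡∁[X∪∁Y] : Y ∩ ∁ X ≡ ∁ (X ∪ ∁ Y)
      Y∖X≡∁[X∪∁Y] = trans (∩-comm Y (∁ X))
                    (trans (cong (∁ X ∩_) (sym (∁-involutive Y))) (sym (∁-∪ X (∁ Y))))

  record DisjointRefinement (a : ℕ) (P Q : EdgeSet H) : Set where
    field
      P′ Q′      : EdgeSet H
      P′⊆P       : P′ ⊆ P
      Q′⊆Q       : Q′ ⊆ Q
      disjoint   : P′ ∩ Q′ ≡ ⊥
      same-union : P′ ∪ Q′ ≡ P ∪ Q
      λP′<a      : lam H P′ < a
      λQ′<a      : lam H Q′ < a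

  -- If Q ∖ P has order ≥ a, posimodularity leaves P ∖ Q of order < a.
  disjoint-refinement : ∀ {a} (P Q : EdgeSet H) → lam H P < a → lam H Q < a → DisjointRefinement a P Q
  disjoint-refinement {a} P Q λP<a λQ<a with a ≤? lam H (Q ∩ ∁ P)
  ... | no a≰λQ∖P = record
    { P′ = P ; Q′ = Q ∩ ∁ P ; P′⊆P = id ; Q′⊆Q = p∩q⊆p Q (∁ P)
    ; disjoint = p-disjoint-q∩∁p P Q ; same-union = p∪q∩∁p≡p∪q P Q
    ; λP′<a = λP<a ; λQ′<a = ≰⇒> a≰λQ∖P }
  ... | yes a≤λQ∖P = record
    { P′ = P ∩ ∁ Q ; Q′ = Q ; P′⊆P = p∩q⊆p P (∁ Q) ; Q′⊆Q = id
    ; disjoint = trans (∩-comm (P ∩ ∁ Q) Q) (p-disjoint-q∩∁p Q P)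
    ; same-union = trans (∪-comm (P ∩ ∁ Q) Q) (trans (p∪q∩∁p≡p∪q Q P) (∪-comm Q P))
    ; λP′<a = +-cancelʳ-≤ a (suc (lam H (P ∩ ∁ Q))) a λP∖Q+a<a+a ; λQ′<a = λQ<a }
    where
    open ≤-Reasoning
    λP∖Q+a<a+a : suc (lam H (P ∩ ∁ Q)) + a ≤ a + a
    λP∖Q+a<a+a = begin
      suc (lam H (P ∩ ∁ Q)) + a                 ≤⟨ +-monoʳ-≤ (suc (lam H (P ∩ ∁ Q))) a≤λQ∖P ⟩
      suc (lam H (P ∩ ∁ Q) + lam H (Q ∩ ∁ P))   ≤⟨ s≤s (λ-posimodular P Q) ⟩
      suc (lam H P) + lam H Q                   ≤⟨ +-mono-≤ λP<a (<⇒≤ λQ<a) ⟩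
      a + a                                     ∎

module WellLinked (H : Hypergraph) {A : EdgeSet H} (tri-well-linked : TriWellLinked H A) where

  bipartition-bound : ∀ {B₁ B₂} → B₁ ∩ B₂ ≡ ⊥ → B₁ ∪ B₂ ≡ A → lam H A ≤ lam H B₁ ⊎ lam H A ≤ lam H B₂
  bipartition-bound {B₁} {B₂} disjoint covers
    with tri-well-linked B₁ B₂ ⊥ disjoint (∩-zeroʳ B₁) (∩-zeroʳ B₂)
           (trans (cong (B₁ ∪_) (∪-identityʳ B₂)) covers)
  ... | inj₁ λA≤λB₁        = inj₁ λA≤λB₁
  ... | inj₂ (inj₁ λA≤λB₂) = inj₂ λA≤λB₂
  ... | inj₂ (inj₂ λA≤λ⊥)  = inj₁ (≤-trans λA≤λ⊥ (≤-trans (≤-reflexive (λ-⊥ H)) z≤n))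

  split-bound : ∀ Y → lam H A ≤ lam H (Y ∩ A) ⊎ lam H A ≤ lam H (∁ Y ∩ A)
  split-bound Y = bipartition-bound (p∩q-disjoint-∁p∩q Y A) (p∩q∪∁p∩q≡q Y A)

  λ-∪-≤ : ∀ Y → lam H A ≤ lam H (Y ∩ A) → lam H (Y ∪ A) ≤ lam H Y
  λ-∪-≤ Y λA≤λY∩A = +-cancelʳ-≤ (lam H (Y ∩ A)) (lam H (Y ∪ A)) (lam H Y) (begin
    lam H (Y ∪ A) + lam H (Y ∩ A) ≤⟨ λ-submodular H Y A ⟩
    lam H Y + lam H A             ≤⟨ +-monoʳ-≤ (lam H Y) λA≤λY∩A ⟩
    lam H Y + lam H (Y ∩ A)       ∎)
    where open ≤-Reasoning

  uncross : ∀ Y → lam H (Y ∪ A) ≤ lam H Y ⊎ lam H (Y ∩ ∁ A) ≤ lam H Y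
  uncross Y with split-bound Y
  ... | inj₁ λA≤λY∩A  = inj₁ (λ-∪-≤ Y λA≤λY∩A)
  ... | inj₂ λA≤λ∁Y∩A = inj₂ (begin
    lam H (Y ∩ ∁ A)     ≡⟨ cong (lam H) (sym ∁[∁Y∪A]≡Y∩∁A) ⟩
    lam H (∁ (∁ Y ∪ A)) ≡⟨ λ-∁ H (∁ Y ∪ A) ⟩
    lam H (∁ Y ∪ A)     ≤⟨ λ-∪-≤ (∁ Y) λA≤λ∁Y∩A ⟩
    lam H (∁ Y)         ≡⟨ λ-∁ H Y ⟩
    lam H Y             ∎)
    where
    open ≤-Reasoning
    ∁[∁Y∪A]≡Y∩∁A : ∁ (∁ Y ∪ A) ≡ Y ∩ ∁ A
    ∁[∁Y∪A]≡Y∩∁A = trans (∁-∪ (∁ Y) A) (cong (_∩ ∁ A) (∁-involutive Y))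

  no-small-cover : ∀ {C₁ C₂ C₃} → C₁ ∪ C₂ ∪ C₃ ≡ A →
                   lam H C₁ < lam H A → lam H C₂ < lam H A → lam H C₃ < lam H A → Empty
  no-small-cover {C₁} {C₂} {C₃} covers λC₁<λA λC₂<λA λC₃<λA =
    [ <⇒≱ R₂.λP′<a , [ <⇒≱ R₃.λP′<a , <⇒≱ R₃.λQ′<a ]′ ]′
      (tri-well-linked E₁ E₂ E₃ E₁∩E₂≡⊥ E₁∩E₃≡⊥ R₃.disjoint E₁∪E₂∪E₃≡A)
    where
    module R₁ = DisjointRefinement (disjoint-refinement H C₁ C₂ λC₁<λA λC₂<λA)
    module R₂ = DisjointRefinement (disjoint-refinement H R₁.P′ C₃ R₁.λP′<a λC₃<λA)
    module R₃ = DisjointRefinement (disjoint-refinement H R₁.Q′ R₂.Q′ R₁.λQ′<a R₂.λQ′<a)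
    E₁ E₂ E₃ : EdgeSet H
    E₁ = R₂.P′
    E₂ = R₃.P′
    E₃ = R₃.Q′
    E₁∩E₂≡⊥ : E₁ ∩ E₂ ≡ ⊥
    E₁∩E₂≡⊥ = ⊆-disjoint R₂.P′⊆P R₃.P′⊆P R₁.disjoint
    E₁∩E₃≡⊥ : E₁ ∩ E₃ ≡ ⊥
    E₁∩E₃≡⊥ = ⊆-disjoint id R₃.Q′⊆Q R₂.disjoint
    E₁∪E₂∪E₃≡A : E₁ ∪ E₂ ∪ E₃ ≡ A
    E₁∪E₂∪E₃≡A = begin
      E₁ ∪ E₂ ∪ E₃           ≡⟨ cong (E₁ ∪_) R₃.same-union ⟩
      E₁ ∪ R₁.Q′ ∪ R₂.Q′     ≡⟨ ∪-left-comm E₁ R₁.Q′ R₂.Q′ ⟩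
      R₁.Q′ ∪ E₁ ∪ R₂.Q′     ≡⟨ cong (R₁.Q′ ∪_) R₂.same-union ⟩
      R₁.Q′ ∪ R₁.P′ ∪ C₃     ≡⟨ ∪-left-comm R₁.Q′ R₁.P′ C₃ ⟩
      R₁.P′ ∪ R₁.Q′ ∪ C₃     ≡⟨ sym (∪-assoc R₁.P′ R₁.Q′ C₃) ⟩
      (R₁.P′ ∪ R₁.Q′) ∪ C₃   ≡⟨ cong (_∪ C₃) R₁.same-union ⟩
      (C₁ ∪ C₂) ∪ C₃         ≡⟨ ∪-assoc C₁ C₂ C₃ ⟩
      C₁ ∪ C₂ ∪ C₃           ≡⟨ covers ⟩
      A                      ∎
      where open ≡-Reasoning

  λ-cover : ∀ Y₁ Y₂ Y₃ → Y₁ ∪ Y₂ ∪ Y₃ ≡ ⊤ →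
            lam H A ≤ lam H (Y₁ ∩ A) ⊎ lam H A ≤ lam H (Y₂ ∩ A) ⊎ lam H A ≤ lam H (Y₃ ∩ A)
  λ-cover Y₁ Y₂ Y₃ covers
    with lam H A ≤? lam H (Y₁ ∩ A) | lam H A ≤? lam H (Y₂ ∩ A) | lam H A ≤? lam H (Y₃ ∩ A)
  ... | yes λA≤λ₁ | _         | _         = inj₁ λA≤λ₁
  ... | no  _     | yes λA≤λ₂ | _         = inj₂ (inj₁ λA≤λ₂)
  ... | no  _     | no  _     | yes λA≤λ₃ = inj₂ (inj₂ λA≤λ₃)
  ... | no  λA≰λ₁ | no  λA≰λ₂ | no  λA≰λ₃ =
    ⊥-elim (no-small-cover traces-cover-A (≰⇒> λA≰λ₁) (≰⇒> λA≰λ₂) (≰⇒> λA≰λ₃))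
    where
    open ≡-Reasoning
    traces-cover-A : Y₁ ∩ A ∪ Y₂ ∩ A ∪ Y₃ ∩ A ≡ A
    traces-cover-A = begin
      Y₁ ∩ A ∪ Y₂ ∩ A ∪ Y₃ ∩ A   ≡⟨ cong (Y₁ ∩ A ∪_) (sym (∩-distribʳ-∪ A Y₂ Y₃)) ⟩
      Y₁ ∩ A ∪ (Y₂ ∪ Y₃) ∩ A     ≡⟨ sym (∩-distribʳ-∪ A Y₁ (Y₂ ∪ Y₃)) ⟩
      (Y₁ ∪ Y₂ ∪ Y₃) ∩ A         ≡⟨ cong (_∩ A) covers ⟩
      ⊤ ∩ A                      ≡⟨ ∩-identityˡ A ⟩
      A                          ∎

-- A subset of E(G ◁ A) is a bit for e_A followed by a subset of the hyperedges outside A, in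
-- their order in G. `extend` puts the bit on every position of A: e_A stands for all of A.
module _ {E : Set} where

  restrict : (xs : List E) (A : Subset (length xs)) → Subset (length xs) → Subset (length (keep xs (∁ A)))
  restrict []       []          []      = []
  restrict (x ∷ xs) (true  ∷ A) (_ ∷ Y) = restrict xs A Y
  restrict (x ∷ xs) (false ∷ A) (y ∷ Y) = y ∷ restrict xs A Y

  extend : (xs : List E) (A : Subset (length xs)) →
           Bool → Subset (length (keep xs (∁ A))) → Subset (length xs)
  extend []       []          b []      = []
  extend (x ∷ xs) (true  ∷ A) b Z       = b ∷ extend xs A b Z
  extend (x ∷ xs) (false ∷ A) b (z ∷ Z) = z ∷ extend xs A b Z

  restrict-extend : ∀ xs A b Z → restrict xs A (extend xs A b Z) ≡ Z
  restrict-extend []       []          b []      = refl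
  restrict-extend (x ∷ xs) (true  ∷ A) b Z       = restrict-extend xs A b Z
  restrict-extend (x ∷ xs) (false ∷ A) b (z ∷ Z) = cong (z ∷_) (restrict-extend xs A b Z)

  extend-restrict-false : ∀ xs A Y → extend xs A false (restrict xs A Y) ≡ Y ∩ ∁ A
  extend-restrict-false []       []          []          = refl
  extend-restrict-false (x ∷ xs) (true  ∷ A) (true  ∷ Y) = cong (false ∷_) (extend-restrict-false xs A Y)
  extend-restrict-false (x ∷ xs) (true  ∷ A) (false ∷ Y) = cong (false ∷_) (extend-restrict-false xs A Y)
  extend-restrict-false (x ∷ xs) (false ∷ A) (true  ∷ Y) = cong (true  ∷_) (extend-restrict-false xs A Y)
  extend-restrict-false (x ∷ xs) (false ∷ A) (false ∷ Y) = cong (false ∷_) (extend-restrict-false xs A Y)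

  extend-restrict-true : ∀ xs A Y → extend xs A true (restrict xs A Y) ≡ Y ∪ A
  extend-restrict-true []       []          []          = refl
  extend-restrict-true (x ∷ xs) (true  ∷ A) (true  ∷ Y) = cong (true  ∷_) (extend-restrict-true xs A Y)
  extend-restrict-true (x ∷ xs) (true  ∷ A) (false ∷ Y) = cong (true  ∷_) (extend-restrict-true xs A Y)
  extend-restrict-true (x ∷ xs) (false ∷ A) (true  ∷ Y) = cong (true  ∷_) (extend-restrict-true xs A Y)
  extend-restrict-true (x ∷ xs) (false ∷ A) (false ∷ Y) = cong (false ∷_) (extend-restrict-true xs A Y)

  extend-true : ∀ xs A Z → extend xs A true Z ≡ A ∪ extend xs A false Z
  extend-true []       []          []      = refl
  extend-true (x ∷ xs) (true  ∷ A) Z       = cong (true ∷_) (extend-true xs A Z)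
  extend-true (x ∷ xs) (false ∷ A) (z ∷ Z) = cong (z ∷_) (extend-true xs A Z)

  extend-false-∪-∁ : ∀ xs A Z → extend xs A false Z ∪ extend xs A false (∁ Z) ≡ ∁ A
  extend-false-∪-∁ []       []          []      = refl
  extend-false-∪-∁ (x ∷ xs) (true  ∷ A) Z       = cong (false ∷_) (extend-false-∪-∁ xs A Z)
  extend-false-∪-∁ (x ∷ xs) (false ∷ A) (z ∷ Z) = cong₂ _∷_ (∨-inverseʳ z) (extend-false-∪-∁ xs A Z)

  ∁-extend : ∀ xs A b Z → ∁ (extend xs A b Z) ≡ extend xs A (not b) (∁ Z)
  ∁-extend []       []          b []      = refl
  ∁-extend (x ∷ xs) (true  ∷ A) b Z       = cong (not b ∷_) (∁-extend xs A b Z)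
  ∁-extend (x ∷ xs) (false ∷ A) b (z ∷ Z) = cong (not z ∷_) (∁-extend xs A b Z)

  restrict-∁ : ∀ xs A Y → restrict xs A (∁ Y) ≡ ∁ (restrict xs A Y)
  restrict-∁ []       []          []      = refl
  restrict-∁ (x ∷ xs) (true  ∷ A) (y ∷ Y) = restrict-∁ xs A Y
  restrict-∁ (x ∷ xs) (false ∷ A) (y ∷ Y) = cong (not y ∷_) (restrict-∁ xs A Y)

  restrict-∪ : ∀ xs A Y Y′ → restrict xs A (Y ∪ Y′) ≡ restrict xs A Y ∪ restrict xs A Y′
  restrict-∪ []       []          []      []        = refl
  restrict-∪ (x ∷ xs) (true  ∷ A) (y ∷ Y) (y′ ∷ Y′) = restrict-∪ xs A Y Y′
  restrict-∪ (x ∷ xs) (false ∷ A) (y ∷ Y) (y′ ∷ Y′) = cong ((y ∨ y′) ∷_) (restrict-∪ xs A Y Y′)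

  restrict-⊤ : ∀ xs A → restrict xs A ⊤ ≡ ⊤
  restrict-⊤ []       []          = refl
  restrict-⊤ (x ∷ xs) (true  ∷ A) = restrict-⊤ xs A
  restrict-⊤ (x ∷ xs) (false ∷ A) = cong (true ∷_) (restrict-⊤ xs A)

  restrict-⊥ : ∀ xs A → restrict xs A ⊥ ≡ ⊥
  restrict-⊥ []       []          = refl
  restrict-⊥ (x ∷ xs) (true  ∷ A) = restrict-⊥ xs A
  restrict-⊥ (x ∷ xs) (false ∷ A) = cong (false ∷_) (restrict-⊥ xs A)

  restrict-⁅⁆-∈ : ∀ xs A e → e ∈ A → restrict xs A ⁅ e ⁆ ≡ ⊥
  restrict-⁅⁆-∈ (x ∷ xs) (true  ∷ A) zero    here       = restrict-⊥ xs A
  restrict-⁅⁆-∈ (x ∷ xs) (true  ∷ A) (suc e) (there e∈A) = restrict-⁅⁆-∈ xs A e e∈A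
  restrict-⁅⁆-∈ (x ∷ xs) (false ∷ A) (suc e) (there e∈A) = cong (false ∷_) (restrict-⁅⁆-∈ xs A e e∈A)

  restrict-⁅⁆-∉ : ∀ xs A e → e ∉ A → ∃[ j ] restrict xs A ⁅ e ⁆ ≡ ⁅ j ⁆
  restrict-⁅⁆-∉ (x ∷ xs) (true  ∷ A) zero    e∉A = ⊥-elim (e∉A here)
  restrict-⁅⁆-∉ (x ∷ xs) (false ∷ A) zero    e∉A = zero , cong (true ∷_) (restrict-⊥ xs A)
  restrict-⁅⁆-∉ (x ∷ xs) (true  ∷ A) (suc e) e∉A = restrict-⁅⁆-∉ xs A e (e∉A ∘ there)
  restrict-⁅⁆-∉ (x ∷ xs) (false ∷ A) (suc e) e∉A =
    map-× suc (cong (false ∷_)) (restrict-⁅⁆-∉ xs A e (e∉A ∘ there))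

  keep-keep : ∀ xs A Z → keep (keep xs (∁ A)) Z ≡ keep xs (extend xs A false Z)
  keep-keep []       []          []          = refl
  keep-keep (x ∷ xs) (true  ∷ A) Z           = keep-keep xs A Z
  keep-keep (x ∷ xs) (false ∷ A) (true  ∷ Z) = cong (x ∷_) (keep-keep xs A Z)
  keep-keep (x ∷ xs) (false ∷ A) (false ∷ Z) = keep-keep xs A Z

module Contraction (G : Hypergraph) (A : EdgeSet G) where

  lift : EdgeSet (G ◁ A) → EdgeSet G
  lift (b ∷ Z) = extend (edges G) A b Z

  lift-∁ : ∀ W → lift (∁ W) ≡ ∁ (lift W)
  lift-∁ (b ∷ Z) = sym (∁-extend (edges G) A b Z)

  -- Since V(Ẑ′) ⊆ V(Ā), intersecting with it turns bd(A) = V(A) ∩ V(Ā) back into V(A).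
  bd-lift-true : ∀ Z → bd (G ◁ A) (true ∷ Z) ≡ bd G (lift (true ∷ Z))
  bd-lift-true Z = begin
    (bd G A ∪ ⋃ (keep K Z)) ∩ ⋃ (keep K (∁ Z))
      ≡⟨ cong₂ (λ P Q → (bd G A ∪ ⋃ P) ∩ ⋃ Q) (keep-keep es A Z) (keep-keep es A (∁ Z)) ⟩
    (VX G A ∩ VX G (∁ A) ∪ VX G Ẑ) ∩ VX G Ẑ′
      ≡⟨ [p∩r∪s]∩q≡[p∪s]∩q (VX G A) (VX G Ẑ′) (VX G (∁ A)) (VX G Ẑ) (⊆⇒∩≡ (VX-mono G Ẑ′⊆∁A)) ⟩
    (VX G A ∪ VX G Ẑ) ∩ VX G Ẑ′
      ≡⟨ cong (_∩ VX G Ẑ′) (sym (VX-∪ G A Ẑ)) ⟩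
    VX G (A ∪ Ẑ) ∩ VX G Ẑ′
      ≡⟨ cong₂ (λ P Q → VX G P ∩ VX G Q) (sym (extend-true es A Z)) (sym (∁-extend es A true Z)) ⟩
    VX G (extend es A true Z) ∩ VX G (∁ (extend es A true Z)) ∎
    where
    open ≡-Reasoning
    es : List (Subset (nV G))
    es = edges G
    K : List (Subset (nV G))
    K = keep es (∁ A)
    Ẑ Ẑ′ : EdgeSet G
    Ẑ = extend es A false Z
    Ẑ′ = extend es A false (∁ Z)
    Ẑ′⊆∁A : Ẑ′ ⊆ ∁ A
    Ẑ′⊆∁A = subst (Ẑ′ ⊆_) (extend-false-∪-∁ es A Z) (q⊆p∪q Ẑ Ẑ′)

  bd-lift : ∀ W → bd (G ◁ A) W ≡ bd G (lift W)
  bd-lift (true ∷ Z) = bd-lift-true Z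
  bd-lift (false ∷ Z) = begin
    bd (G ◁ A) (false ∷ Z)              ≡⟨ cong (λ Z′ → bd (G ◁ A) (false ∷ Z′)) (sym (∁-involutive Z)) ⟩
    bd (G ◁ A) (∁ (true ∷ ∁ Z))         ≡⟨ bd-∁ (G ◁ A) (true ∷ ∁ Z) ⟩
    bd (G ◁ A) (true ∷ ∁ Z)             ≡⟨ bd-lift-true (∁ Z) ⟩
    bd G (lift (true ∷ ∁ Z))            ≡⟨ cong (bd G) (sym (∁-extend (edges G) A false Z)) ⟩
    bd G (∁ (lift (false ∷ Z)))         ≡⟨ bd-∁ G (lift (false ∷ Z)) ⟩
    bd G (lift (false ∷ Z))             ∎
    where open ≡-Reasoning

  λ-lift : ∀ W → lam (G ◁ A) W ≡ lam G (lift W)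
  λ-lift W = cong ∣_∣ (bd-lift W)

  contract : Bool → EdgeSet G → EdgeSet (G ◁ A)
  contract b Y = b ∷ restrict (edges G) A Y

  contract-lift : ∀ b Z → contract b (lift (b ∷ Z)) ≡ b ∷ Z
  contract-lift b Z = cong (b ∷_) (restrict-extend (edges G) A b Z)

  ∁-contract : ∀ b Y → ∁ (contract b Y) ≡ contract (not b) (∁ Y)
  ∁-contract b Y = cong (not b ∷_) (sym (restrict-∁ (edges G) A Y))

  λ-contract-true : ∀ Y → lam (G ◁ A) (contract true Y) ≡ lam G (Y ∪ A)
  λ-contract-true Y = trans (λ-lift (contract true Y)) (cong (lam G) (extend-restrict-true (edges G) A Y))

  λ-contract-false : ∀ Y → lam (G ◁ A) (contract false Y) ≡ lam G (Y ∩ ∁ A)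
  λ-contract-false Y = trans (λ-lift (contract false Y)) (cong (lam G) (extend-restrict-false (edges G) A Y))

  contract-true-⊥ : contract true ⊥ ≡ ⁅ zero ⁆
  contract-true-⊥ = cong (true ∷_) (restrict-⊥ (edges G) A)

  λ-⁅e_A⁆ : lam (G ◁ A) ⁅ zero ⁆ ≡ lam G A
  λ-⁅e_A⁆ = begin
    lam (G ◁ A) ⁅ zero ⁆           ≡⟨ cong (lam (G ◁ A)) (sym contract-true-⊥) ⟩
    lam (G ◁ A) (contract true ⊥)  ≡⟨ λ-contract-true ⊥ ⟩
    lam G (⊥ ∪ A)                  ≡⟨ cong (lam G) (∪-identityˡ A) ⟩
    lam G A                        ∎
    where open ≡-Reasoning

  contract-cover : ∀ {b₁ b₂ b₃} X Y Z → X ∪ Y ∪ Z ≡ ⊤ → b₁ ∨ b₂ ∨ b₃ ≡ true →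
                   contract b₁ X ∪ contract b₂ Y ∪ contract b₃ Z ≡ ⊤
  contract-cover X Y Z covers some-bᵢ = cong₂ _∷_ some-bᵢ (begin
    restrict es A X ∪ restrict es A Y ∪ restrict es A Z ≡⟨ cong (restrict es A X ∪_) (sym (restrict-∪ es A Y Z)) ⟩
    restrict es A X ∪ restrict es A (Y ∪ Z)             ≡⟨ sym (restrict-∪ es A X (Y ∪ Z)) ⟩
    restrict es A (X ∪ Y ∪ Z)                           ≡⟨ cong (restrict es A) covers ⟩
    restrict es A ⊤                                     ≡⟨ restrict-⊤ es A ⟩
    ⊤                                                   ∎)
    where
    open ≡-Reasoning
    es : List (Subset (nV G))
    es = edges G

  contract-∁⁅⁆-∈ : ∀ b {e} → e ∈ A → contract b (∁ ⁅ e ⁆) ≡ b ∷ ⊤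
  contract-∁⁅⁆-∈ b {e} e∈A = cong (b ∷_) (begin
    restrict (edges G) A (∁ ⁅ e ⁆) ≡⟨ restrict-∁ (edges G) A ⁅ e ⁆ ⟩
    ∁ (restrict (edges G) A ⁅ e ⁆) ≡⟨ cong ∁ (restrict-⁅⁆-∈ (edges G) A e e∈A) ⟩
    ∁ ⊥                            ≡⟨ ∁⊥≡⊤ ⟩
    ⊤                              ∎)
    where open ≡-Reasoning

  contract-true-∁⁅⁆-∉ : ∀ {e} → e ∉ A → ∃[ j ] contract true (∁ ⁅ e ⁆) ≡ ∁ ⁅ j ⁆
  contract-true-∁⁅⁆-∉ {e} e∉A with restrict-⁅⁆-∉ (edges G) A e e∉A
  ... | j , restrict-⁅e⁆≡⁅j⁆ =
    suc j , cong (true ∷_) (trans (restrict-∁ (edges G) A ⁅ e ⁆) (cong ∁ restrict-⁅e⁆≡⁅j⁆))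

  λ-contract-⁅⁆-∉ : ∀ {e} → e ∉ A → lam (G ◁ A) (contract false ⁅ e ⁆) ≡ lam G (∁ ⁅ e ⁆)
  λ-contract-⁅⁆-∉ {e} e∉A =
    trans (λ-contract-false ⁅ e ⁆) (trans (cong (lam G) (x∉p⇒⁅x⁆∩∁p≡⁅x⁆ A e∉A)) (sym (λ-∁ G ⁅ e ⁆)))

contract-order-≤ : (G : Hypergraph) {A : EdgeSet G} → TriWellLinked G A →
                   ∀ Y → ∃[ b ] lam (G ◁ A) (Contraction.contract G A b Y) ≤ lam G Y
contract-order-≤ G {A} tri-well-linked Y with WellLinked.uncross G tri-well-linked Y
... | inj₁ λY∪A≤λY = true  , subst (_≤ lam G Y) (sym (λ-contract-true Y)) λY∪A≤λY
  where open Contraction G A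
... | inj₂ λY∖A≤λY = false , subst (_≤ lam G Y) (sym (λ-contract-false Y)) λY∖A≤λY
  where open Contraction G A

∃-Bool? : {P : Bool → Set} → Dec (P false) → Dec (P true) → Dec (∃[ b ] P b)
∃-Bool? P-false? P-true? = map′ [ (false ,_) , (true ,_) ]′ from-∃ (P-false? ⊎-dec P-true?)
  where
  from-∃ : ∀ {P : Bool → Set} → ∃[ b ] P b → P false ⊎ P true
  from-∃ (false , p) = inj₁ p
  from-∃ (true  , p) = inj₂ p

module Pullback (G : Hypergraph) {A : EdgeSet G}
  (A-tri-well-linked : TriWellLinked G A) (∁A-tri-well-linked : TriWellLinked G (∁ A))
  {k′ : ℕ} {T : Family (G ◁ A)} (tangle : IsTangle (G ◁ A) k′ T) where

  open Contraction G A

  H : Hypergraph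
  H = G ◁ A

  In-T : EdgeSet H → Set
  In-T W = InF H W T

  private
    order : ∀ W → In-T W → lam H W < k′
    order = proj₁ tangle
    orient : ∀ W → lam H W < k′ → In-T W ⊎ In-T (∁ W)
    orient = proj₁ (proj₂ tangle)
    no-triple-cover : ∀ X Y Z → In-T X → In-T Y → In-T Z → X ∪ Y ∪ Z ≢ ⊤
    no-triple-cover = proj₁ (proj₂ (proj₂ tangle))
    no-cosingleton : ∀ e → ¬ In-T (∁ ⁅ e ⁆)
    no-cosingleton = proj₂ (proj₂ (proj₂ tangle))

  cover-contradiction : ∀ {b₁ b₂ b₃} X Y Z → X ∪ Y ∪ Z ≡ ⊤ → b₁ ∨ b₂ ∨ b₃ ≡ true →
                        In-T (contract b₁ X) → In-T (contract b₂ Y) → In-T (contract b₃ Z) → Empty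
  cover-contradiction {b₁} {b₂} {b₃} X Y Z covers some-bᵢ X∈T Y∈T Z∈T =
    no-triple-cover _ _ _ X∈T Y∈T Z∈T (contract-cover {b₁} {b₂} {b₃} X Y Z covers some-bᵢ)

  λA<k′ : ∀ Y → In-T (contract false Y) → In-T (contract false (∁ Y)) → lam G A < k′
  λA<k′ Y Y∈T ∁Y∈T = subst (_< k′) (λ-∁ G A) ([ λ∁A≤λY∖A , λ∁A≤λ∁Y∖A ]′ (split-bound-∁A Y))
    where
    open WellLinked G ∁A-tri-well-linked renaming (split-bound to split-bound-∁A)
    λ∁A≤λY∖A : lam G (∁ A) ≤ lam G (Y ∩ ∁ A) → lam G (∁ A) < k′
    λ∁A≤λY∖A λ∁A≤ = ≤-<-trans λ∁A≤ (subst (_< k′) (λ-contract-false Y) (order _ Y∈T))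
    λ∁A≤λ∁Y∖A : lam G (∁ A) ≤ lam G (∁ Y ∩ ∁ A) → lam G (∁ A) < k′
    λ∁A≤λ∁Y∖A λ∁A≤ = ≤-<-trans λ∁A≤ (subst (_< k′) (λ-contract-false (∁ Y)) (order _ ∁Y∈T))

  no-complementary-restrictions : ∀ Y → In-T (contract false Y) → In-T (contract false (∁ Y)) → Empty
  no-complementary-restrictions Y Y∈T ∁Y∈T
    with orient ⁅ zero ⁆ (subst (_< k′) (sym λ-⁅e_A⁆) (λA<k′ Y Y∈T ∁Y∈T))
  ... | inj₁ e_A∈T  = cover-contradiction Y (∁ Y) ⊥ Y∪∁Y∪⊥≡⊤ refl Y∈T ∁Y∈T
                        (subst In-T (sym contract-true-⊥) e_A∈T)
    where
    Y∪∁Y∪⊥≡⊤ : Y ∪ ∁ Y ∪ ⊥ ≡ ⊤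
    Y∪∁Y∪⊥≡⊤ = trans (cong (Y ∪_) (∪-identityʳ (∁ Y))) (∪-inverseʳ Y)
  ... | inj₂ ∁e_A∈T = no-cosingleton zero ∁e_A∈T

  raise : ∀ W → lam G W < k′ → lam G A ≤ lam G (W ∩ A) → In-T (contract false W) → In-T (contract true W)
  raise W λW<k′ λA≤λW∩A W∈T with orient (contract true W) λW∪A<k′
    where
    λW∪A<k′ : lam H (contract true W) < k′
    λW∪A<k′ = subst (_< k′) (sym (λ-contract-true W))
                (≤-<-trans (WellLinked.λ-∪-≤ G A-tri-well-linked W λA≤λW∩A) λW<k′)
  ... | inj₁ W∪A∈T   = W∪A∈T
  ... | inj₂ ∁W∪A∈T = ⊥-elim (no-complementary-restrictions W W∈T (subst In-T (∁-contract true W) ∁W∪A∈T))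

  InPullback : EdgeSet G → Set
  InPullback Y = lam G Y < k′ × ∃[ b ] In-T (contract b Y)

  inPullback? : ∀ Y → Dec (InPullback Y)
  inPullback? Y = (lam G Y <? k′) ×-dec ∃-Bool? (T (contract false Y) ≟ true) (T (contract true Y) ≟ true)

  pullback : Family G
  pullback Y = ⌊ inPullback? Y ⌋

  pullback-intro : ∀ {Y} → InPullback Y → InF G Y pullback
  pullback-intro {Y} inPullback = Equivalence.to T-≡ (fromWitness {a? = inPullback? Y} inPullback)

  pullback-elim : ∀ {Y} → InF G Y pullback → InPullback Y
  pullback-elim {Y} Y∈ = toWitness {a? = inPullback? Y} (Equivalence.from T-≡ Y∈)

  pullback-orient : ∀ Y → lam G Y < k′ → InF G Y pullback ⊎ InF G (∁ Y) pullback
  pullback-orient Y λY<k′ with contract-order-≤ G A-tri-well-linked Y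
  ... | b , λ≤λY with orient (contract b Y) (≤-<-trans λ≤λY λY<k′)
  ...   | inj₁ Y′∈T  = inj₁ (pullback-intro (λY<k′ , b , Y′∈T))
  ...   | inj₂ ∁Y′∈T = inj₂ (pullback-intro (subst (_< k′) (sym (λ-∁ G Y)) λY<k′ , not b ,
                                            subst In-T (∁-contract b Y) ∁Y′∈T))

  pullback-no-triple-cover : ∀ X Y Z → InF G X pullback → InF G Y pullback → InF G Z pullback → X ∪ Y ∪ Z ≢ ⊤
  pullback-no-triple-cover X Y Z X∈ Y∈ Z∈ covers
    with pullback-elim X∈ | pullback-elim Y∈ | pullback-elim Z∈
  ... | λX<k′ , bX , X′∈T | λY<k′ , bY , Y′∈T | λZ<k′ , bZ , Z′∈T = by-bits bX bY bZ X′∈T Y′∈T Z′∈T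
    where
    by-bits : ∀ b₁ b₂ b₃ → In-T (contract b₁ X) → In-T (contract b₂ Y) → In-T (contract b₃ Z) → Empty
    by-bits true  _     _     = cover-contradiction X Y Z covers refl
    by-bits false true  _     = cover-contradiction X Y Z covers refl
    by-bits false false true  = cover-contradiction X Y Z covers refl
    by-bits false false false X′∈T Y′∈T Z′∈T with WellLinked.λ-cover G A-tri-well-linked X Y Z covers
    ... | inj₁ λA≤λX∩A        = cover-contradiction X Y Z covers refl (raise X λX<k′ λA≤λX∩A X′∈T) Y′∈T Z′∈T
    ... | inj₂ (inj₁ λA≤λY∩A) = cover-contradiction X Y Z covers refl X′∈T (raise Y λY<k′ λA≤λY∩A Y′∈T) Z′∈T
    ... | inj₂ (inj₂ λA≤λZ∩A) = cover-contradiction X Y Z covers refl X′∈T Y′∈T (raise Z λZ<k′ λA≤λZ∩A Z′∈T)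

  contract-true-∁⁅⁆∉T : ∀ {e} → e ∉ A → ¬ In-T (contract true (∁ ⁅ e ⁆))
  contract-true-∁⁅⁆∉T e∉A with contract-true-∁⁅⁆-∉ e∉A
  ... | j , contract≡∁⁅j⁆ = no-cosingleton j ∘ subst In-T contract≡∁⁅j⁆

  pullback-no-cosingleton : ∀ e → ¬ InF G (∁ ⁅ e ⁆) pullback
  pullback-no-cosingleton e ∁e∈ with pullback-elim ∁e∈ | e ∈? A
  ... | _ , true , ∁e′∈T | yes e∈A =
    no-triple-cover ⊤ ⊤ ⊤ ⊤∈T ⊤∈T ⊤∈T (trans (cong (⊤ ∪_) (∪-idem ⊤)) (∪-idem ⊤))
    where
    ⊤∈T : In-T ⊤
    ⊤∈T = subst In-T (contract-∁⁅⁆-∈ true e∈A) ∁e′∈T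
  ... | _ , false , ∁e′∈T | yes e∈A =
    no-cosingleton zero (subst In-T (trans (contract-∁⁅⁆-∈ false e∈A) (cong (false ∷_) (sym ∁⊥≡⊤))) ∁e′∈T)
  ... | _ , true , ∁e′∈T | no e∉A = contract-true-∁⁅⁆∉T e∉A ∁e′∈T
  ... | λ∁e<k′ , false , ∁e′∈T | no e∉A
    with orient (contract false ⁅ e ⁆) (subst (_< k′) (sym (λ-contract-⁅⁆-∉ e∉A)) λ∁e<k′)
  ...   | inj₁ e′∈T  = no-complementary-restrictions ⁅ e ⁆ e′∈T ∁e′∈T
  ...   | inj₂ ∁e′∈T = contract-true-∁⁅⁆∉T e∉A (subst In-T (∁-contract false ⁅ e ⁆) ∁e′∈T)

  pullback-isTangle : IsTangle G k′ pullback
  pullback-isTangle =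
    (λ Y → proj₁ ∘ pullback-elim) , pullback-orient , pullback-no-triple-cover , pullback-no-cosingleton

  lift-∈-pullback : ∀ W → In-T W → InF G (lift W) pullback
  lift-∈-pullback (b ∷ Z) W∈T = pullback-intro
    (subst (_< k′) (λ-lift (b ∷ Z)) (order _ W∈T) , b , subst In-T (sym (contract-lift b Z)) W∈T)

contraction-tangle-unbreakable : ∀ {k} (G : Hypergraph) {A : EdgeSet G} →
  TriWellLinked G A → TriWellLinked G (∁ A) → TangleUnbreakable k G → TangleUnbreakable k (G ◁ A)
contraction-tangle-unbreakable {k} G {A} A-twl ∁A-twl unbreakable
                               k₁ k₂ T₁ T₂ tangle₁ tangle₂ W λW<k (W∈T₁ , ∁W∈T₂) =
  unbreakable k₁ k₂ P₁.pullback P₂.pullback P₁.pullback-isTangle P₂.pullback-isTangle (lift W)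
    (subst (_< k) (λ-lift W) λW<k)
    (P₁.lift-∈-pullback W W∈T₁ ,
     subst (λ X → InF G X P₂.pullback) (lift-∁ W) (P₂.lift-∈-pullback (∁ W) ∁W∈T₂))
  where
  open Contraction G A
  module P₁ = Pullback G A-twl ∁A-twl tangle₁
  module P₂ = Pullback G A-twl ∁A-twl tangle₂

lemma6p19 : (k : ℕ) (G : Hypergraph) (A : EdgeSet G) →
    TangleUnbreakable k G →
    TriWellLinked G A → TriWellLinked G (∁ A) →
    TangleUnbreakable k (G ◁ A) × TangleUnbreakable k (G ◁ ∁ A)
lemma6p19 k G A unbreakable A-twl ∁A-twl =
  contraction-tangle-unbreakable G A-twl ∁A-twl unbreakable ,
  contraction-tangle-unbreakable G ∁A-twl (subst (TriWellLinked G) (sym (∁-involutive A)) A-twl) unbreakable
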